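{- Let $\mathcal{I}=\langle S,\circ,*,i,e\rangle$ be a Routley IF. Then: (a) for all $t,u\in S$, $(t\circ u)^*=t^*$ or $(t\circ u)^*=u^*$; (b) for all $t,u\in S$, $t^*\le u^*$ or $u^*\le t^*$; (c) for all $t\in S$, $t^*\le t^{**}$ or $t^{**}\le t^*$.
   Context: A Routley IF is a structure $\langle S,\circ,*,i,e\rangle$ where $S$ is a nonempty set, $\circ$ is an associative, commutative, idempotent binary operation on $S$, $*:S\to S$, and $i\neq e$ are elements of $S$ such that: $s\circ i=s$ and $s\circ e=e$ for all $s$; if $e=t\circ u$ then $e=t$ or $e=u$; and, writing $s\le t$ iff $s\circ t=s$: $i^*=e$ and $e^*=i$; $t\le u$ implies $u^*\le t^*$; for all $t,u$, $(t\circ u)^*\le t^*$ or $(t\circ u)^*\le u^*$. -}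

module Defs where

open import Level using (Level; suc)
open import Relation.Binary.PropositionalEquality using (_≡_)
open import Relation.Nullary using (¬_)
open import Data.Sum using (_⊎_)

-- A Routley IF ⟨S, ∘, *, i, e⟩ (S nonempty: witnessed by i).
record RoutleyIF (a : Level) : Set (suc a) where
  infixl 7 _∘_
  infix 4 _≤_
  field
    S   : Set a
    _∘_ : S → S → S
    _*  : S → S
    i   : S
    e   : S
    ∘-assoc : ∀ s t u → (s ∘ t) ∘ u ≡ s ∘ (t ∘ u)
    ∘-comm  : ∀ s t → s ∘ t ≡ t ∘ s
    ∘-idem  : ∀ s → s ∘ s ≡ s
    i≢e     : ¬ (i ≡ e)
    ∘-identity : ∀ s → s ∘ i ≡ s
    ∘-zero     : ∀ s → s ∘ e ≡ e
    e-prime    : ∀ t u → e ≡ t ∘ u → (e ≡ t) ⊎ (e ≡ u)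

  _≤_ : S → S → Set a
  s ≤ t = s ∘ t ≡ s

  field
    i*≡e : i * ≡ e
    e*≡i : e * ≡ i
    *-antitone : ∀ t u → t ≤ u → u * ≤ t *
    *-split    : ∀ t u → ((t ∘ u) * ≤ t *) ⊎ ((t ∘ u) * ≤ u *)

module Submission where

open import Defs
open import Level using (Level)
open import Relation.Binary.PropositionalEquality using (_≡_; sym; cong; subst; module ≡-Reasoning)
open import Data.Sum using (_⊎_; inj₁; inj₂; map)
open import Data.Product using (_×_; _,_)

-- Since t ∘ u lies below both t and u, antitonicity puts both t* and u* below (t ∘ u)*;
-- the split axiom puts (t ∘ u)* below one of them, so it equals that one, and the other
-- is then below it.

module RoutleyIFProperties {a : Level} (I : RoutleyIF a) where
  open RoutleyIF I
  open ≡-Reasoning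

  ≤-antisym : ∀ {x y} → x ≤ y → y ≤ x → x ≡ y
  ≤-antisym {x} {y} x≤y y≤x = begin
    x      ≡⟨ sym x≤y ⟩
    x ∘ y  ≡⟨ ∘-comm x y ⟩
    y ∘ x  ≡⟨ y≤x ⟩
    y      ∎

  x∘y≤x : ∀ x y → x ∘ y ≤ x
  x∘y≤x x y = begin
    (x ∘ y) ∘ x  ≡⟨ ∘-assoc x y x ⟩
    x ∘ (y ∘ x)  ≡⟨ cong (x ∘_) (∘-comm y x) ⟩
    x ∘ (x ∘ y)  ≡⟨ sym (∘-assoc x x y) ⟩
    (x ∘ x) ∘ y  ≡⟨ cong (_∘ y) (∘-idem x) ⟩
    x ∘ y        ∎

  x∘y≤y : ∀ x y → x ∘ y ≤ y
  x∘y≤y x y = begin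
    (x ∘ y) ∘ y  ≡⟨ ∘-assoc x y y ⟩
    x ∘ (y ∘ y)  ≡⟨ cong (x ∘_) (∘-idem y) ⟩
    x ∘ y        ∎

  *-∘-≡ : ∀ t u → ((t ∘ u) * ≡ t *) ⊎ ((t ∘ u) * ≡ u *)
  *-∘-≡ t u = map (λ le → ≤-antisym le (*-antitone _ _ (x∘y≤x t u)))
                  (λ le → ≤-antisym le (*-antitone _ _ (x∘y≤y t u)))
                  (*-split t u)

  *-total : ∀ t u → (t * ≤ u *) ⊎ (u * ≤ t *)
  *-total t u with *-∘-≡ t u
  ... | inj₁ eq = inj₂ (subst (u * ≤_) eq (*-antitone _ _ (x∘y≤y t u)))
  ... | inj₂ eq = inj₁ (subst (t * ≤_) eq (*-antitone _ _ (x∘y≤x t u)))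

proposition3 : ∀ {a : Level} (I : RoutleyIF a) → let open RoutleyIF I in
    (∀ t u → ((t ∘ u) * ≡ t *) ⊎ ((t ∘ u) * ≡ u *))
    × (∀ t u → (t * ≤ u *) ⊎ (u * ≤ t *))
    × (∀ t → (t * ≤ (t *) *) ⊎ ((t *) * ≤ t *))
proposition3 I = *-∘-≡ , *-total , (λ t → *-total t (t *))
  where
    open RoutleyIF I
    open RoutleyIFProperties I
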